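{- Consider a weighted-POMDP with state set $S$, initial state $\bar{s}$, actions $A$, observations $Z$, and specification $\phi=P_{\unlhd p}[\phi_1\,\mathcal{U}^{\leq k}\phi_2]$, modified so that all states satisfying $\neg\phi_1$ or $\phi_2$ are absorbing, and let $\Delta=\{s\in S: s\models\phi_2\}$. With the value functions $V_t$ defined in the context, for every $k\ge 0$ and every history $h$, $V_k(h)$ equals the maximum (over actions chosen as functions of histories) accumulated weighted probability mass of paths satisfying $\phi_1\,\mathcal{U}^{\leq k}\phi_2$ starting from history $h$, i.e. the maximum weighted probability mass, starting from the weighted belief $C(h)\,b(\cdot|h)$, of reaching $\Delta$ within at most $k$ steps.
   Context: A weighted-POMDP is a tuple $\{S,\bar{s},A,Z,T,O\}$ as a POMDP (finite $S,A,Z$; $O:S\times Z\to[0,1]$ with $\sum_{z}O(s,z)=1$ for all $s$) except that $T:S\times A\times S\to[0,1]$ need not satisfy $\sum_{s'}T(s,a,s')=1$ (the sum may exceed $1$). A history is $h_t=a_0z_1\dots a_{t-1}z_t$; $h_0$ is the empty history. Define $C(h_0)=1$, $b(s|h_0)=1$ if $s=\bar{s}$ and $0$ otherwise, and for a history $h$ extended by $a,z$: $b(s'|haz)=\dfrac{\sum_{s}O(s',z)T(s,a,s')b(s|h)C(h)}{\sum_{s''}\sum_{s}O(s'',z)T(s,a,s'')b(s|h)C(h)}$, $\;C(haz)=C(h)\sum_{s}\sum_{s'}b(s|h)T(s,a,s')$. Derived MDP on histories: $T_M(h,a,haz)=\dfrac{\sum_{s''}\sum_{s}O(s'',z)T(s,a,s'')b(s|h)C(h)}{\sum_{z'\in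 Z}\sum_{s''}\sum_{s}O(s'',z')T(s,a,s'')b(s|h)C(h)}$. Value functions: $V_0(h)=C(h)\sum_{s\in\Delta}b(s|h)$ and $V_t(h)=\max_{a\in A}\sum_{z\in Z}T_M(h,a,haz)V_{t-1}(haz)$ for $t\ge1$.
   Formalization: The transition function $T$ and the observation function $O$ of the weighted-POMDP take rational values in $[0,1]$. -}

module Defs where

open import Data.Nat using (ℕ; zero; suc)
open import Data.Fin using (Fin; zero; suc)
open import Data.Bool using (Bool; true; false; if_then_else_; not; _∨_)
open import Data.List using (List; []; _∷_)
open import Data.Product using (_×_; _,_)
open import Data.Rational using (ℚ; 0ℚ; 1ℚ; _+_; _*_; _÷_; _⊔_; _≤_; ≢-nonZero)
open import Data.Rational.Properties using (_≟_)
open import Relation.Nullary using (yes; no)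
open import Relation.Nullary.Decidable using (⌊_⌋)
open import Relation.Binary.PropositionalEquality using (_≡_)
import Data.Fin as F

Σ : {n : ℕ} → (Fin n → ℚ) → ℚ
Σ {zero}  f = 0ℚ
Σ {suc n} f = f zero + Σ (λ i → f (suc i))

Max : {n : ℕ} → (Fin (suc n) → ℚ) → ℚ
Max {zero}  f = f zero
Max {suc n} f = f zero ⊔ Max (λ i → f (suc i))

-- Total division with the convention x / 0 = 0 (only used in 0/0 situations).
_/₀_ : ℚ → ℚ → ℚ
x /₀ y with y ≟ 0ℚ
... | yes _  = 0ℚ
... | no y≢0 = _÷_ x y {{≢-nonZero y≢0}}
infixl 7 _/₀_

-- Weighted-POMDP over rational weights.  States Fin nS, actions Fin (suc nA)
-- (a nonempty finite set, so that max over actions exists), observations Fin nZ.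
record WPOMDP : Set where
  field
    nS nA nZ : ℕ
    init  : Fin nS
    T     : Fin nS → Fin (suc nA) → Fin nS → ℚ
    O     : Fin nS → Fin nZ → ℚ
    T-nonneg : ∀ s a s' → 0ℚ ≤ T s a s'
    T-le1    : ∀ s a s' → T s a s' ≤ 1ℚ
    O-nonneg : ∀ s z → 0ℚ ≤ O s z
    O-le1    : ∀ s z → O s z ≤ 1ℚ
    O-sum    : ∀ s → Σ (λ z → O s z) ≡ 1ℚ

module _ (M : WPOMDP) where
  open WPOMDP M

  State = Fin nS
  Act   = Fin (suc nA)
  Obs   = Fin nZ

  -- Histories, stored most-recent-first: the history  h a z  is  (a , z) ∷ h.
  History : Set
  History = List (Act × Obs)

  indicator : Bool → ℚ
  indicator true  = 1ℚ
  indicator false = 0ℚ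

  mutual
    C : History → ℚ
    C []            = 1ℚ
    C ((a , z) ∷ h) = C h * Σ (λ s → Σ (λ s' → b h s * T s a s'))

    b : History → State → ℚ
    b []            s' = indicator (⌊ s' F.≟ init ⌋)
    b ((a , z) ∷ h) s' = num h a z s' /₀ Σ (λ s'' → num h a z s'')

    num : History → Act → Obs → State → ℚ
    num h a z s' = Σ (λ s → O s' z * T s a s' * b h s * C h)

  TM : History → Act → Obs → ℚ
  TM h a z = Σ (λ s'' → num h a z s'') /₀ Σ (λ z' → Σ (λ s'' → num h a z' s''))

  -- Value functions; Δ = { s | φ₂ s = true }.
  V : (φ₂ : State → Bool) → ℕ → History → ℚ
  V φ₂ zero    h = C h * Σ (λ s → if φ₂ s then b h s else 0ℚ)
  V φ₂ (suc t) h = Max (λ a → Σ (λ z → TM h a z * V φ₂ t ((a , z) ∷ h)))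

  Absorbing : (φ₁ φ₂ : State → Bool) → Set
  Absorbing φ₁ φ₂ = ∀ s → (not (φ₁ s) ∨ φ₂ s) ≡ true →
    ∀ a s' → T s a s' ≡ indicator ⌊ s F.≟ s' ⌋

  -- Monitor for the path formula φ₁ U φ₂ along a path prefix.
  data UStatus : Set where
    pending satisfied failed : UStatus

  step : (φ₁ φ₂ : State → Bool) → UStatus → State → UStatus
  step φ₁ φ₂ pending s = if φ₂ s then satisfied else (if φ₁ s then pending else failed)
  step φ₁ φ₂ satisfied s = satisfied
  step φ₁ φ₂ failed s = failed

  isSat : UStatus → Bool
  isSat satisfied = true
  isSat _         = false

  Policy : Set
  Policy = History → Act

  -- pathMass φ₁ φ₂ σ k h s st : total weight of all paths s = s₀ z₁ s₁ … z_k s_k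
  -- (weight ∏ T(sᵢ, σ(hᵢ), sᵢ₊₁) O(sᵢ₊₁, zᵢ₊₁), hᵢ the history extended by the
  -- actions/observations so far) whose states satisfy φ₁ U φ₂, given that the
  -- monitor status before s is st.
  pathMass : (φ₁ φ₂ : State → Bool) → Policy → ℕ → History → State → UStatus → ℚ
  pathMass φ₁ φ₂ σ zero    h s st = indicator (isSat (step φ₁ φ₂ st s))
  pathMass φ₁ φ₂ σ (suc k) h s st =
    Σ (λ s' → Σ (λ z → T s (σ h) s' * O s' z *
        pathMass φ₁ φ₂ σ k ((σ h , z) ∷ h) s' (step φ₁ φ₂ st s)))

  untilMass : (φ₁ φ₂ : State → Bool) → Policy → ℕ → History → ℚ
  untilMass φ₁ φ₂ σ k h = Σ (λ s → C h * b h s * pathMass φ₁ φ₂ σ k h s pending)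

{-# OPTIONS --safe #-}
-- Unfolding the path mass by one step and summing over the first transition, the mass under σ
-- from h becomes Σ_z Σ_s' num(h, σ h, z, s') · (mass from s' after h σ(h) z). By Bayes' rule
-- num(h, a, z, s') = TM(h, a, z) · C(h a z) · b(s' | h a z), where both sides vanish when the
-- observation z has mass zero, so the until-mass satisfies the Bellman equation of the derived
-- MDP on histories, with the maximum replaced by the action of σ.  Absorption of the states
-- satisfying ¬φ₁ ∨ φ₂ makes the status of the until-monitor irrelevant after the first step.
-- Induction on k then bounds every policy by V, and the policy choosing a maximising action at
-- every history attains V.
module Submission where

open import Defs
open import Data.Nat using (ℕ)
open import Data.Fin using (Fin)
open import Data.Bool using (Bool)
open import Data.Product using (_×_; Σ-syntax)
open import Data.Rational using (_≤_)
open import Relation.Binary.PropositionalEquality using (_≡_)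

open import Data.Nat using (zero; suc; _+_; _∸_)
open import Data.Nat.Properties using (+-suc; m+n∸n≡m)
open import Data.Fin using (zero; suc)
import Data.Fin as F
open import Data.Bool using (true; false; if_then_else_; not; _∨_)
open import Data.List using ([]; _∷_; length)
open import Data.Product using (_,_; proj₁; proj₂; ∃)
open import Data.Sum using (inj₁; inj₂)
open import Data.Rational
  using (ℚ; 0ℚ; 1ℚ; _*_; _÷_; 1/_; NonZero; Positive; ≢-nonZero; nonNegative)
  renaming (_+_ to _+ℚ_)
open import Data.Rational.Properties
open import Data.Rational.Solver using (module +-*-Solver)
open import Algebra.Bundles using (CommutativeRing)
open import Algebra.Properties.Semiring.Sum (CommutativeRing.semiring +-*-commutativeRing)
  using (sum; sum-cong-≗; sum-replicate-zero; ∑-comm; *-distribˡ-sum; *-distribʳ-sum)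
open import Relation.Binary.PropositionalEquality
  using (refl; sym; trans; cong; cong₂; subst; _≢_; module ≡-Reasoning)
open import Relation.Nullary using (yes; no)
open import Relation.Nullary.Decidable using (⌊_⌋)
open import Relation.Nullary.Negation using (contradiction)

open +-*-Solver using (solve; _:*_; _:=_; con)

Σ≡sum : ∀ {n} (f : Fin n → ℚ) → Σ f ≡ sum f
Σ≡sum {zero}  f = refl
Σ≡sum {suc n} f = cong (f zero +ℚ_) (Σ≡sum (λ i → f (suc i)))

Σ-cong : ∀ {n} {f g : Fin n → ℚ} → (∀ i → f i ≡ g i) → Σ f ≡ Σ g
Σ-cong {f = f} {g} f≗g = trans (Σ≡sum f) (trans (sum-cong-≗ f≗g) (sym (Σ≡sum g)))

Σ-zero : ∀ n → Σ {n} (λ _ → 0ℚ) ≡ 0ℚ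
Σ-zero n = trans (Σ≡sum {n} (λ _ → 0ℚ)) (sum-replicate-zero n)

*-distribˡ-Σ : ∀ {n} x (f : Fin n → ℚ) → x * Σ f ≡ Σ (λ i → x * f i)
*-distribˡ-Σ x f = begin
  x * Σ f               ≡⟨ cong (x *_) (Σ≡sum f) ⟩
  x * sum f             ≡⟨ *-distribˡ-sum x f ⟩
  sum (λ i → x * f i)   ≡⟨ sym (Σ≡sum (λ i → x * f i)) ⟩
  Σ (λ i → x * f i)     ∎
  where open ≡-Reasoning

*-distribʳ-Σ : ∀ {n} x (f : Fin n → ℚ) → Σ f * x ≡ Σ (λ i → f i * x)
*-distribʳ-Σ x f = begin
  Σ f * x               ≡⟨ cong (_* x) (Σ≡sum f) ⟩
  sum f * x             ≡⟨ *-distribʳ-sum x f ⟩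
  sum (λ i → f i * x)   ≡⟨ sym (Σ≡sum (λ i → f i * x)) ⟩
  Σ (λ i → f i * x)     ∎
  where open ≡-Reasoning

Σ-comm : ∀ {m n} (f : Fin m → Fin n → ℚ) →
         Σ (λ i → Σ (λ j → f i j)) ≡ Σ (λ j → Σ (λ i → f i j))
Σ-comm f = trans (ΣΣ≡sumsum f) (trans (∑-comm f) (sym (ΣΣ≡sumsum (λ j i → f i j))))
  where
  ΣΣ≡sumsum : ∀ {m n} (g : Fin m → Fin n → ℚ) →
              Σ (λ i → Σ (g i)) ≡ sum (λ i → sum (g i))
  ΣΣ≡sumsum g = trans (Σ≡sum (λ i → Σ (g i))) (sum-cong-≗ (λ i → Σ≡sum (g i)))

Σ-mono-≤ : ∀ {n} {f g : Fin n → ℚ} → (∀ i → f i ≤ g i) → Σ f ≤ Σ g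
Σ-mono-≤ {zero}  f≤g = ≤-refl
Σ-mono-≤ {suc n} f≤g = +-mono-≤ (f≤g zero) (Σ-mono-≤ (λ i → f≤g (suc i)))

Σ-nonneg : ∀ {n} {f : Fin n → ℚ} → (∀ i → 0ℚ ≤ f i) → 0ℚ ≤ Σ f
Σ-nonneg {n} {f} 0≤f = subst (_≤ Σ f) (Σ-zero n) (Σ-mono-≤ 0≤f)

term≤Σ : ∀ {n} (f : Fin n → ℚ) → (∀ i → 0ℚ ≤ f i) → ∀ i → f i ≤ Σ f
term≤Σ f 0≤f zero = begin
  f zero                          ≡⟨ sym (+-identityʳ (f zero)) ⟩
  f zero +ℚ 0ℚ                    ≤⟨ +-monoʳ-≤ (f zero) (Σ-nonneg (λ i → 0≤f (suc i))) ⟩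
  f zero +ℚ Σ (λ i → f (suc i))   ∎
  where open ≤-Reasoning
term≤Σ f 0≤f (suc i) = begin
  f (suc i)                       ≤⟨ term≤Σ (λ i → f (suc i)) (λ i → 0≤f (suc i)) i ⟩
  Σ (λ i → f (suc i))             ≡⟨ sym (+-identityˡ _) ⟩
  0ℚ +ℚ Σ (λ i → f (suc i))       ≤⟨ +-monoˡ-≤ _ (0≤f zero) ⟩
  f zero +ℚ Σ (λ i → f (suc i))   ∎
  where open ≤-Reasoning

Σ≡0⇒term≡0 : ∀ {n} (f : Fin n → ℚ) → (∀ i → 0ℚ ≤ f i) → Σ f ≡ 0ℚ → ∀ i → f i ≡ 0ℚ
Σ≡0⇒term≡0 f 0≤f Σf≡0 i = ≤-antisym (subst (f i ≤_) Σf≡0 (term≤Σ f 0≤f i)) (0≤f i)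

term≤Max : ∀ {n} (f : Fin (suc n) → ℚ) i → f i ≤ Max f
term≤Max {zero}  f zero    = ≤-refl
term≤Max {suc n} f zero    = p≤p⊔q (f zero) _
term≤Max {suc n} f (suc i) = ≤-trans (term≤Max (λ i → f (suc i)) i) (p≤q⊔p (f zero) _)

Max-attained : ∀ {n} (f : Fin (suc n) → ℚ) → ∃ λ i → f i ≡ Max f
Max-attained {zero}  f = zero , refl
Max-attained {suc n} f with ≤-total (f zero) (Max (λ i → f (suc i)))
... | inj₁ f₀≤max = let i , fi≡max = Max-attained (λ i → f (suc i)) in
                    suc i , trans fi≡max (sym (p≤q⇒p⊔q≡q f₀≤max))
... | inj₂ max≤f₀ = zero , sym (p≥q⇒p⊔q≡p max≤f₀)

*-nonneg : ∀ {p q} → 0ℚ ≤ p → 0ℚ ≤ q → 0ℚ ≤ p * q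
*-nonneg {p} {q} 0≤p 0≤q =
  nonNegative⁻¹ _ {{nonNeg*nonNeg⇒nonNeg p {{nonNegative 0≤p}} q {{nonNegative 0≤q}}}}

0/₀ : ∀ y → 0ℚ /₀ y ≡ 0ℚ
0/₀ y with y ≟ 0ℚ
... | yes _   = refl
... | no y≢0 = *-zeroˡ ((1/ y) {{≢-nonZero y≢0}})

/₀-≢0 : ∀ x {y} (y≢0 : y ≢ 0ℚ) → x /₀ y ≡ (x ÷ y) {{≢-nonZero y≢0}}
/₀-≢0 x {y} y≢0 with y ≟ 0ℚ
... | yes y≡0 = contradiction y≡0 y≢0
... | no _    = refl

/₀-nonneg : ∀ {x y} → 0ℚ ≤ x → 0ℚ ≤ y → 0ℚ ≤ x /₀ y
/₀-nonneg {x} {y} 0≤x 0≤y with y ≟ 0ℚ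
... | yes _   = ≤-refl
... | no y≢0 = *-nonneg 0≤x (nonNegative⁻¹ (1/ y) {{pos⇒nonNeg (1/ y) {{1/y>0}}}})
  where
  instance
    _ : NonZero y
    _ = ≢-nonZero y≢0
  1/y>0 : Positive (1/ y)
  1/y>0 = 1/pos⇒pos y {{nonNeg∧nonZero⇒pos y {{nonNegative 0≤y}}}}

-- The hypotheses rule out the junk value of _/₀_: if n ≡ 0 both sides vanish, and n ≢ 0 forces d ≢ 0.
/₀-cancel : ∀ x n d → (n ≡ 0ℚ → x ≡ 0ℚ) → (d ≡ 0ℚ → n ≡ 0ℚ) → n /₀ d * (d * (x /₀ n)) ≡ x
/₀-cancel x n d n≡0⇒x≡0 d≡0⇒n≡0 with n ≟ 0ℚ
... | yes refl = trans (cong (_* (d * 0ℚ)) (0/₀ d)) (trans (*-zeroˡ (d * 0ℚ)) (sym (n≡0⇒x≡0 refl)))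
... | no n≢0 = begin
  n /₀ d * (d * (x * 1/n))              ≡⟨ cong (λ u → u * (d * (x * 1/n))) (/₀-≢0 n d≢0) ⟩
  n * 1/d * (d * (x * 1/n))             ≡⟨ solve 5 (λ n d x 1/n 1/d → n :* 1/d :* (d :* (x :* 1/n))
                                                  := n :* 1/n :* (d :* 1/d) :* x) refl n d x 1/n 1/d ⟩
  n * 1/n * (d * 1/d) * x               ≡⟨ cong₂ (λ u v → u * v * x) (*-inverseʳ n {{≢-nonZero n≢0}})
                                                                     (*-inverseʳ d {{≢-nonZero d≢0}}) ⟩
  1ℚ * 1ℚ * x                           ≡⟨ solve 1 (λ x → con 1ℚ :* con 1ℚ :* x := x) refl x ⟩
  x                                     ∎
  where
  open ≡-Reasoning
  d≢0 : d ≢ 0ℚ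
  d≢0 d≡0 = n≢0 (d≡0⇒n≡0 d≡0)
  1/n 1/d : ℚ
  1/n = (1/ n) {{≢-nonZero n≢0}}
  1/d = (1/ d) {{≢-nonZero d≢0}}

module Belief (M : WPOMDP) where
  open WPOMDP M

  indicator-nonneg : ∀ β → 0ℚ ≤ indicator M β
  indicator-nonneg true  = nonNegative⁻¹ 1ℚ
  indicator-nonneg false = ≤-refl

  mutual
    C-nonneg : ∀ h → 0ℚ ≤ C M h
    C-nonneg []            = indicator-nonneg true
    C-nonneg ((a , z) ∷ h) =
      *-nonneg (C-nonneg h) (Σ-nonneg λ s → Σ-nonneg λ s' → *-nonneg (b-nonneg h s) (T-nonneg s a s'))

    b-nonneg : ∀ h s → 0ℚ ≤ b M h s
    b-nonneg []            s  = indicator-nonneg ⌊ s F.≟ init ⌋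
    b-nonneg ((a , z) ∷ h) s' = /₀-nonneg (num-nonneg h a z s') (Σ-nonneg (num-nonneg h a z))

    num-nonneg : ∀ h a z s' → 0ℚ ≤ num M h a z s'
    num-nonneg h a z s' = Σ-nonneg λ s →
      *-nonneg (*-nonneg (*-nonneg (O-nonneg s' z) (T-nonneg s a s')) (b-nonneg h s)) (C-nonneg h)

  TM-nonneg : ∀ h a z → 0ℚ ≤ TM M h a z
  TM-nonneg h a z = /₀-nonneg (Σ-nonneg (num-nonneg h a z)) (Σ-nonneg λ z' → Σ-nonneg (num-nonneg h a z'))

  O-sum-* : ∀ s x → Σ (λ z → O s z * x) ≡ x
  O-sum-* s x = trans (sym (*-distribʳ-Σ x (O s))) (trans (cong (_* x) (O-sum s)) (*-identityˡ x))

  -- C (h a z) does not depend on z: it is the total one-step mass, with the observations summed out.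
  Σ-num≡C : ∀ h a z → Σ (λ z' → Σ (num M h a z')) ≡ C M ((a , z) ∷ h)
  Σ-num≡C h a z = begin
    Σ (λ z' → Σ λ s' → Σ λ s → O s' z' * T s a s' * b M h s * C M h)
      ≡⟨ Σ-comm (λ z' s' → Σ λ s → O s' z' * T s a s' * b M h s * C M h) ⟩
    Σ (λ s' → Σ λ z' → Σ λ s → O s' z' * T s a s' * b M h s * C M h)
      ≡⟨ Σ-cong (λ s' → Σ-comm (λ z' s → O s' z' * T s a s' * b M h s * C M h)) ⟩
    Σ (λ s' → Σ λ s → Σ λ z' → O s' z' * T s a s' * b M h s * C M h)
      ≡⟨ Σ-cong (λ s' → Σ-cong λ s → trans (Σ-cong λ z' → reassoc (O s' z') (T s a s') (b M h s) (C M h))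
                                          (O-sum-* s' (C M h * (b M h s * T s a s')))) ⟩
    Σ (λ s' → Σ λ s → C M h * (b M h s * T s a s'))
      ≡⟨ Σ-comm (λ s' s → C M h * (b M h s * T s a s')) ⟩
    Σ (λ s → Σ λ s' → C M h * (b M h s * T s a s'))
      ≡⟨ Σ-cong (λ s → sym (*-distribˡ-Σ (C M h) (λ s' → b M h s * T s a s'))) ⟩
    Σ (λ s → C M h * Σ λ s' → b M h s * T s a s')
      ≡⟨ sym (*-distribˡ-Σ (C M h) (λ s → Σ λ s' → b M h s * T s a s')) ⟩
    C M ((a , z) ∷ h)
      ∎
    where
    open ≡-Reasoning
    reassoc : ∀ o t x c → o * t * x * c ≡ o * (c * (x * t))
    reassoc = solve 4 (λ o t x c → o :* t :* x :* c := o :* (c :* (x :* t))) refl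

  TM*C*b≡num : ∀ h a z s' → TM M h a z * (C M ((a , z) ∷ h) * b M ((a , z) ∷ h) s') ≡ num M h a z s'
  TM*C*b≡num h a z s' = begin
    TM M h a z * (C M ((a , z) ∷ h) * b M ((a , z) ∷ h) s')
      ≡⟨ cong (λ c → TM M h a z * (c * b M ((a , z) ∷ h) s')) (sym (Σ-num≡C h a z)) ⟩
    obs /₀ all * (all * (num M h a z s' /₀ obs))
      ≡⟨ /₀-cancel (num M h a z s') obs all
           (λ obs≡0 → Σ≡0⇒term≡0 (num M h a z) (num-nonneg h a z) obs≡0 s')
           (λ all≡0 → Σ≡0⇒term≡0 (λ z' → Σ (num M h a z')) (λ z' → Σ-nonneg (num-nonneg h a z')) all≡0 z) ⟩
    num M h a z s'
      ∎
    where
    open ≡-Reasoning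
    obs all : ℚ
    obs = Σ (num M h a z)
    all = Σ (λ z' → Σ (num M h a z'))

module Until (M : WPOMDP) (φ₁ φ₂ : State M → Bool) where
  open WPOMDP M
  open Belief M

  next : UStatus M → State M → UStatus M
  next = step M φ₁ φ₂

  mass : Policy M → ℕ → History M → State M → UStatus M → ℚ
  mass = pathMass M φ₁ φ₂

  until : Policy M → ℕ → History M → ℚ
  until = untilMass M φ₁ φ₂

  value : ℕ → History M → ℚ
  value = V M φ₂

  Q : ℕ → History M → Act M → ℚ
  Q t h a = Σ λ z → TM M h a z * value t ((a , z) ∷ h)

  next-idem : ∀ st s → next (next st s) s ≡ next st s
  next-idem pending   s with φ₂ s in φ₂s | φ₁ s in φ₁s
  ... | true  | _     = refl
  ... | false | true  rewrite φ₂s | φ₁s = refl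
  ... | false | false = refl
  next-idem satisfied s = refl
  next-idem failed    s = refl

  isSat-next-pending : ∀ s → isSat M (next pending s) ≡ φ₂ s
  isSat-next-pending s with φ₂ s | φ₁ s
  ... | true  | _     = refl
  ... | false | true  = refl
  ... | false | false = refl

  next-pending : ∀ s → (not (φ₁ s) ∨ φ₂ s) ≡ false → next pending s ≡ pending
  next-pending s undecided with φ₁ s | φ₂ s
  next-pending s undecided  | true  | false = refl
  next-pending s ()         | true  | true
  next-pending s ()         | false | _

  mass-cong : ∀ σ k h s {st st'} → next st s ≡ next st' s → mass σ k h s st ≡ mass σ k h s st'
  mass-cong σ zero    h s eq = cong (λ st → indicator M (isSat M st)) eq
  mass-cong σ (suc k) h s eq =
    cong (λ st → Σ λ s' → Σ λ z → T s (σ h) s' * O s' z * mass σ k ((σ h , z) ∷ h) s' st) eq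

  *-indicator : ∀ x β → x * indicator M β ≡ (if β then x else 0ℚ)
  *-indicator x true  = *-identityʳ x
  *-indicator x false = *-zeroʳ x

  until-zero : ∀ σ h → until σ 0 h ≡ value 0 h
  until-zero σ h = begin
    Σ (λ s → C M h * b M h s * indicator M (isSat M (next pending s)))
      ≡⟨ Σ-cong (λ s → *-assoc (C M h) (b M h s) _) ⟩
    Σ (λ s → C M h * (b M h s * indicator M (isSat M (next pending s))))
      ≡⟨ Σ-cong (λ s → cong (λ β → C M h * (b M h s * indicator M β)) (isSat-next-pending s)) ⟩
    Σ (λ s → C M h * (b M h s * indicator M (φ₂ s)))
      ≡⟨ Σ-cong (λ s → cong (C M h *_) (*-indicator (b M h s) (φ₂ s))) ⟩
    Σ (λ s → C M h * (if φ₂ s then b M h s else 0ℚ))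
      ≡⟨ sym (*-distribˡ-Σ (C M h) (λ s → if φ₂ s then b M h s else 0ℚ)) ⟩
    value 0 h
      ∎
    where open ≡-Reasoning

  -- A policy sees only the history; under horizon n, a history of length l leaves n ∸ l steps.
  greedy : ℕ → Policy M
  greedy n h = proj₁ (Max-attained (Q (n ∸ suc (length h)) h))

  greedy-optimal : ∀ n r h → n ∸ suc (length h) ≡ r → Q r h (greedy n h) ≡ value (suc r) h
  greedy-optimal n _ h refl = proj₂ (Max-attained (Q (n ∸ suc (length h)) h))

  module _ (absorbing : Absorbing M φ₁ φ₂) where

    -- A first state that decides φ₁ U φ₂ can only move to itself, where the monitor
    -- takes the same decision again; so the status it produced can be forgotten.
    absorbing-step : ∀ σ k h a s s' →
      T s a s' * mass σ k h s' (next pending s) ≡ T s a s' * mass σ k h s' pending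
    absorbing-step σ k h a s s' with not (φ₁ s) ∨ φ₂ s in decided
    ... | false = cong (λ st → T s a s' * mass σ k h s' st) (next-pending s decided)
    ... | true with s F.≟ s' | absorbing s decided a s'
    ...   | yes refl | _    = cong (T s a s *_) (mass-cong σ k h s (next-idem pending s))
    ...   | no _     | T≡0 = zero-* T≡0
      where
      zero-* : ∀ {t x y} → t ≡ 0ℚ → t * x ≡ t * y
      zero-* {x = x} {y} refl = trans (*-zeroˡ x) (sym (*-zeroˡ y))

    until-suc-num : ∀ σ k h → until σ (suc k) h ≡
      Σ λ z → Σ λ s' → num M h (σ h) z s' * mass σ k ((σ h , z) ∷ h) s' pending
    until-suc-num σ k h = begin
      Σ (λ s → C M h * b M h s * Σ λ s' → Σ λ z → step-weight s s' z)
        ≡⟨ Σ-cong (λ s → trans (*-distribˡ-Σ (C M h * b M h s) (λ s' → Σ (step-weight s s'))) (Σ-cong λ s' →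
             trans (*-distribˡ-Σ (C M h * b M h s) (step-weight s s')) (Σ-cong λ z → term s s' z))) ⟩
      Σ (λ s → Σ λ s' → Σ λ z → w z s' s * P z s')
        ≡⟨ Σ-comm (λ s s' → Σ λ z → w z s' s * P z s') ⟩
      Σ (λ s' → Σ λ s → Σ λ z → w z s' s * P z s')
        ≡⟨ Σ-cong (λ s' → Σ-comm (λ s z → w z s' s * P z s')) ⟩
      Σ (λ s' → Σ λ z → Σ λ s → w z s' s * P z s')
        ≡⟨ Σ-comm (λ s' z → Σ λ s → w z s' s * P z s') ⟩
      Σ (λ z → Σ λ s' → Σ λ s → w z s' s * P z s')
        ≡⟨ Σ-cong (λ z → Σ-cong λ s' → sym (*-distribʳ-Σ (P z s') (w z s'))) ⟩
      Σ (λ z → Σ λ s' → num M h a z s' * P z s')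
        ∎
      where
      open ≡-Reasoning
      a : Act M
      a = σ h
      h′ : Obs M → History M
      h′ z = (a , z) ∷ h
      P : Obs M → State M → ℚ
      P z s' = mass σ k (h′ z) s' pending
      step-weight : State M → State M → Obs M → ℚ
      step-weight s s' z = T s a s' * O s' z * mass σ k (h′ z) s' (next pending s)
      w : Obs M → State M → State M → ℚ
      w z s' s = O s' z * T s a s' * b M h s * C M h
      term : ∀ s s' z → C M h * b M h s * step-weight s s' z ≡ w z s' s * P z s'
      term s s' z = begin
        C M h * b M h s * (T s a s' * O s' z * mass σ k (h′ z) s' (next pending s))
          ≡⟨ solve 5 (λ c x t o p → c :* x :* (t :* o :* p) := o :* (c :* x) :* (t :* p)) refl
                     (C M h) (b M h s) (T s a s') (O s' z) _ ⟩
        O s' z * (C M h * b M h s) * (T s a s' * mass σ k (h′ z) s' (next pending s))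
          ≡⟨ cong (O s' z * (C M h * b M h s) *_) (absorbing-step σ k (h′ z) a s s') ⟩
        O s' z * (C M h * b M h s) * (T s a s' * P z s')
          ≡⟨ solve 5 (λ c x t o p → o :* (c :* x) :* (t :* p) := o :* t :* x :* c :* p) refl
                     (C M h) (b M h s) (T s a s') (O s' z) (P z s') ⟩
        w z s' s * P z s'
          ∎

    until-suc : ∀ σ k h → until σ (suc k) h ≡ Σ λ z → TM M h (σ h) z * until σ k ((σ h , z) ∷ h)
    until-suc σ k h = begin
      until σ (suc k) h
        ≡⟨ until-suc-num σ k h ⟩
      Σ (λ z → Σ λ s' → num M h a z s' * P z s')
        ≡⟨ Σ-cong (λ z → Σ-cong λ s' → cong (_* P z s') (sym (TM*C*b≡num h a z s'))) ⟩
      Σ (λ z → Σ λ s' → TM M h a z * (C M (h′ z) * b M (h′ z) s') * P z s')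
        ≡⟨ Σ-cong (λ z → Σ-cong λ s' → *-assoc (TM M h a z) _ (P z s')) ⟩
      Σ (λ z → Σ λ s' → TM M h a z * (C M (h′ z) * b M (h′ z) s' * P z s'))
        ≡⟨ Σ-cong (λ z → sym (*-distribˡ-Σ (TM M h a z) λ s' → C M (h′ z) * b M (h′ z) s' * P z s')) ⟩
      Σ (λ z → TM M h a z * until σ k (h′ z))
        ∎
      where
      open ≡-Reasoning
      a : Act M
      a = σ h
      h′ : Obs M → History M
      h′ z = (a , z) ∷ h
      P : Obs M → State M → ℚ
      P z s' = mass σ k (h′ z) s' pending

    until≤value : ∀ σ k h → until σ k h ≤ value k h
    until≤value σ zero    h = ≤-reflexive (until-zero σ h)
    until≤value σ (suc k) h = begin
      until σ (suc k) h                                   ≡⟨ until-suc σ k h ⟩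
      Σ (λ z → TM M h (σ h) z * until σ k ((σ h , z) ∷ h)) ≤⟨ Σ-mono-≤ (λ z → *-monoˡ-≤-nonNeg (TM M h (σ h) z)
                                                              {{nonNegative (TM-nonneg h (σ h) z)}}
                                                              (until≤value σ k ((σ h , z) ∷ h))) ⟩
      Q k h (σ h)                                         ≤⟨ term≤Max (Q k h) (σ h) ⟩
      value (suc k) h                                     ∎
      where open ≤-Reasoning

    until-greedy : ∀ n r h → r + length h ≡ n → until (greedy n) r h ≡ value r h
    until-greedy n zero    h _     = until-zero (greedy n) h
    until-greedy n (suc r) h r+l≡n = begin
      until (greedy n) (suc r) h
        ≡⟨ until-suc (greedy n) r h ⟩
      Σ (λ z → TM M h a z * until (greedy n) r ((a , z) ∷ h))
        ≡⟨ Σ-cong (λ z → cong (TM M h a z *_)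
             (until-greedy n r ((a , z) ∷ h) (trans (+-suc r (length h)) r+l≡n))) ⟩
      Q r h a
        ≡⟨ greedy-optimal n r h (trans (cong (_∸ suc (length h)) (sym r+l≡n)) (m+n∸n≡m r (length h))) ⟩
      value (suc r) h
        ∎
      where
      open ≡-Reasoning
      a : Act M
      a = greedy n h

theorem3 : (M : WPOMDP) (φ₁ φ₂ : Fin (WPOMDP.nS M) → Bool) →
    Absorbing M φ₁ φ₂ →
    (k : ℕ) (h : History M) →
      ((σ : Policy M) → untilMass M φ₁ φ₂ σ k h ≤ V M φ₂ k h)
      × (Σ[ σ ∈ Policy M ] untilMass M φ₁ φ₂ σ k h ≡ V M φ₂ k h)
theorem3 M φ₁ φ₂ absorbing k h =
  (λ σ → until≤value absorbing σ k h) , greedy (k + length h) , until-greedy absorbing (k + length h) k h refl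
  where open Until M φ₁ φ₂
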